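{- Let $m,z\in\mathbb{N}$, $\epsilon>0$, $\gamma>0$, $\Omega>0$ and $k>0$. Let $H$ be an $n$-vertex graph and $F$ a graph with $V(F)=[\ell]$ and $\mathrm{maxdeg}(F)\le m$; let $\mathcal Z=\{Z_1,\dots,Z_z\}$ be a partition of $V(H)$ and $\{W_1,\dots,W_\ell\}$ a family of pairwise disjoint subsets of $V(H)$ with $2|W_i|\ge|W_j|$ for all $i,j\in[\ell]$. Suppose that for each $i\in[\ell]$, $W_i^{(0)},W_i^{(1)},\dots,W_i^{(p_i)}$ is a partition of $W_i$ such that for all $i,j\in[\ell]$: (a) $1/\epsilon\le p_i$; (b) $|W_i^{(i')}|=|W_j^{(j')}|$ for all $i'\in[p_i]$, $j'\in[p_j]$; (c) each $W_i^{(i')}$, $i'\in[p_i]$, lies inside some $Z_x$; (d) $\sum_i|W_i^{(0)}|<\epsilon\sum_i|W_i|$; (e) at most $\epsilon|\mathcal Y|$ pairs of $\mathcal Y:=\{(W_i^{(i')},W_j^{(j')}) : ij\in E(F), i'\in[p_i], j'\in[p_j]\}$ are $\epsilon$-irregular in $H$. Suppose moreover that $\mathrm{maxdeg}(H)\le\Omega k$, $e(H)\le kn$, every edge $xy\in E(H)$ satisfies $x\in W_i$, $y\in W_j$ for some $ij\in E(F)$, and $\mathrm{d}(W_i,W_j)\ge\gamma$ whenever $ij\in E(F)$. Then all but at most $\left(\frac{4\epsilon}{\gamma}+\epsilon\Omega+\gamma\right)nk$ edges of $H$ belong to $\epsilon$-regular pairs $(W_i^{(i')},W_j^{(j')})$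 with $i'\in[p_i]$, $j'\in[p_j]$ (i.e. $i',j'\neq0$) of density at least $\gamma^2$.
   Context: $[n]=\{1,\dots,n\}$. For disjoint vertex sets $U,W$ of $H$, $e(U,W)$ is the number of edges between them and $\mathrm{d}(U,W)=e(U,W)/(|U||W|)$. A pair $(U,W)$ is $\epsilon$-regular if $|\mathrm{d}(U,W)-\mathrm{d}(U',W')|<\epsilon$ for all $U'\subseteq U$, $W'\subseteq W$ with $|U'|\ge\epsilon|U|$, $|W'|\ge\epsilon|W|$; otherwise $\epsilon$-irregular. -}

module Defs where

open import Data.Nat as ℕ using (ℕ; zero; suc; _+_; _*_)
open import Data.Nat.Base using (_<ᵇ_)
open import Data.Integer as ℤ using (ℤ)
open import Data.Rational as ℚ using (ℚ; 0ℚ; _/_; _-_; ∣_∣; _≤_; _<_)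
open import Data.Fin using (Fin; zero; suc; toℕ)
open import Data.Bool using (Bool; true; false; if_then_else_; _∧_)
open import Relation.Binary.PropositionalEquality using (_≡_)

sumF : ∀ {k} → (Fin k → ℕ) → ℕ
sumF {zero}  f = 0
sumF {suc k} f = f zero + sumF (λ x → f (suc x))

[_] : Bool → ℕ
[ b ] = if b then 1 else 0

count : ∀ {k} → (Fin k → Bool) → ℕ
count P = sumF (λ x → [ P x ])

ℕ→ℚ : ℕ → ℚ
ℕ→ℚ n = ℤ.+ n / 1

record Graph (n : ℕ) : Set where
  field
    adj     : Fin n → Fin n → Bool
    sym     : ∀ x y → adj x y ≡ adj y x
    irrefl  : ∀ x → adj x x ≡ false
open Graph public

VSet : ℕ → Set
VSet n = Fin n → Bool

∣_∣ᵥ : ∀ {n} → VSet n → ℕ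
∣ U ∣ᵥ = count U

_⊆ᵥ_ : ∀ {n} → VSet n → VSet n → Set
U ⊆ᵥ W = ∀ v → U v ≡ true → W v ≡ true

deg : ∀ {n} → Graph n → Fin n → ℕ
deg G x = count (adj G x)

eG : ∀ {n} → Graph n → ℕ
eG G = sumF (λ x → sumF (λ y → [ (toℕ x <ᵇ toℕ y) ∧ adj G x y ]))

eUW : ∀ {n} → Graph n → VSet n → VSet n → ℕ
eUW G U W = sumF (λ x → sumF (λ y → [ U x ∧ W y ∧ adj G x y ]))

-- d(U,W) = e(U,W)/(|U||W|)   (convention: 0 if U or W is empty)
dens : ∀ {n} → Graph n → VSet n → VSet n → ℚ
dens G U W with ∣ U ∣ᵥ * ∣ W ∣ᵥ
... | zero  = 0ℚ
... | suc k = ℤ.+ (eUW G U W) / suc k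

Regular : ∀ {n} → ℚ → Graph n → VSet n → VSet n → Set
Regular ε G U W =
  ∀ (U' W' : VSet _) → U' ⊆ᵥ U → W' ⊆ᵥ W →
  ε ℚ.* ℕ→ℚ ∣ U ∣ᵥ ≤ ℕ→ℚ ∣ U' ∣ᵥ →
  ε ℚ.* ℕ→ℚ ∣ W ∣ᵥ ≤ ℕ→ℚ ∣ W' ∣ᵥ →
  ∣ dens G U W - dens G U' W' ∣ < ε

{-# OPTIONS --safe #-}
module Submission where

-- An edge that lies in no ε-regular
-- pair of clusters W_i^(i'), W_j^(j') (i', j' ≠ 0) of density ≥ γ² has an endpoint in an
-- exceptional set W_i^(0), or lies in a cluster pair of the set S from (e), or in a pair of
-- density < γ². Exceptional endpoints meet at most Δ(H) Σ|W_i^(0)| ≤ Ωk εn edges. By (b) all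
-- clusters have a common size s, and since d(W_i,W_j) ≥ γ,
--   (number of ordered F-pairs of clusters) s² ≤ Σ_{ij ∈ F} |W_i||W_j| ≤ 2e(H)/γ ≤ 2kn/γ.
-- So the pairs in S carry at most ε 2kn/γ edges and the sparse pairs at most γ² 2kn/γ; the
-- latter halves to γkn because sparseness is symmetric and each edge is seen from both ends.

open import Defs renaming (sym to adj-sym)
open import Data.Nat as ℕ using (ℕ; zero; suc)
open import Data.Nat.Base using (_<ᵇ_)
import Data.Nat.Properties as ℕₚ
open import Data.Rational as ℚ using (ℚ; 0ℚ; 1/_; >-nonZero)
open import Data.Fin using (Fin; zero; suc; toℕ; fromℕ<)
open import Data.Fin.Properties using (any?; toℕ<n)
open import Data.Bool using (Bool; true; false; _∧_; _∨_)
open import Data.Product using (Σ; ∃-syntax; _×_; _,_; proj₁; proj₂)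
open import Function using (_∘_)
open import Relation.Binary.PropositionalEquality
  using (_≡_; _≢_; refl; sym; trans; cong; cong₂; subst; subst₂; module ≡-Reasoning)
open import Relation.Nullary using (¬_; Dec; yes; no; contradiction)
open import Relation.Nullary.Decidable using (isNo)

isNo≡false⇒ : ∀ {A : Set} (a? : Dec A) → isNo a? ≡ false → A
isNo≡false⇒ (yes a) _ = a

isNo≡true⇒ : ∀ {A : Set} (a? : Dec A) → isNo a? ≡ true → ¬ A
isNo≡true⇒ (no ¬a) _ = ¬a

module FiniteSums where

  open import Data.Nat using (_+_; _*_; _≤_; z≤n; s≤s)
  open import Data.Nat.Properties hiding (suc-injective)
  open import Data.Fin.Properties using (suc-injective) renaming (_≟_ to _≟ᶠ_)
  open import Algebra.Properties.CommutativeSemigroup +-commutativeSemigroup using (interchange)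

  sumF-cong : ∀ {k} {f g : Fin k → ℕ} → (∀ x → f x ≡ g x) → sumF f ≡ sumF g
  sumF-cong {zero}  f≗g = refl
  sumF-cong {suc k} f≗g = cong₂ _+_ (f≗g zero) (sumF-cong (f≗g ∘ suc))

  sumF-mono-≤ : ∀ {k} {f g : Fin k → ℕ} → (∀ x → f x ≤ g x) → sumF f ≤ sumF g
  sumF-mono-≤ {zero}  f≤g = z≤n
  sumF-mono-≤ {suc k} f≤g = +-mono-≤ (f≤g zero) (sumF-mono-≤ (f≤g ∘ suc))

  sumF-distrib-+ : ∀ {k} (f g : Fin k → ℕ) → sumF (λ x → f x + g x) ≡ sumF f + sumF g
  sumF-distrib-+ {zero}  f g = refl
  sumF-distrib-+ {suc k} f g = trans (cong (f zero + g zero +_) (sumF-distrib-+ (f ∘ suc) (g ∘ suc)))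
                                     (interchange (f zero) (g zero) (sumF (f ∘ suc)) (sumF (g ∘ suc)))

  *-distribˡ-sumF : ∀ {k} c (f : Fin k → ℕ) → c * sumF f ≡ sumF (λ x → c * f x)
  *-distribˡ-sumF {zero}  c f = *-zeroʳ c
  *-distribˡ-sumF {suc k} c f = trans (*-distribˡ-+ c (f zero) (sumF (f ∘ suc)))
                                      (cong (c * f zero +_) (*-distribˡ-sumF c (f ∘ suc)))

  *-distribʳ-sumF : ∀ {k} c (f : Fin k → ℕ) → sumF f * c ≡ sumF (λ x → f x * c)
  *-distribʳ-sumF {zero}  c f = refl
  *-distribʳ-sumF {suc k} c f = trans (*-distribʳ-+ c (f zero) (sumF (f ∘ suc)))
                                      (cong (f zero * c +_) (*-distribʳ-sumF c (f ∘ suc)))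

  sumF-const : ∀ {k} c → sumF {k} (λ _ → c) ≡ k * c
  sumF-const {zero}  c = refl
  sumF-const {suc k} c = cong (c +_) (sumF-const {k} c)

  sumF-zero : ∀ {k} → sumF {k} (λ _ → 0) ≡ 0
  sumF-zero {k} = trans (sumF-const {k} 0) (*-zeroʳ k)

  sumF-comm : ∀ {k l} (f : Fin k → Fin l → ℕ) →
              sumF (λ x → sumF (λ y → f x y)) ≡ sumF (λ y → sumF (λ x → f x y))
  sumF-comm {zero}  {l} f = sym (sumF-zero {l})
  sumF-comm {suc k}     f = trans (cong (sumF (f zero) +_) (sumF-comm (f ∘ suc)))
                                  (sym (sumF-distrib-+ (f zero) (λ y → sumF (λ x → f (suc x) y))))

  term≤sumF : ∀ {k} (f : Fin k → ℕ) x → f x ≤ sumF f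
  term≤sumF f zero    = m≤m+n _ _
  term≤sumF f (suc x) = ≤-trans (term≤sumF (f ∘ suc) x) (m≤n+m _ (f zero))

  []-∧ : ∀ a b → [ a ∧ b ] ≡ [ a ] * [ b ]
  []-∧ true  b = sym (+-identityʳ [ b ])
  []-∧ false b = refl

  []≤1 : ∀ b → [ b ] ≤ 1
  []≤1 true  = s≤s z≤n
  []≤1 false = z≤n

  []-∧-≤ʳ : ∀ a b → [ a ∧ b ] ≤ [ a ]
  []-∧-≤ʳ false b = z≤n
  []-∧-≤ʳ true  b = []≤1 b

  []-∧-∨ : ∀ a b c → [ a ∧ (b ∨ c) ] ≤ [ a ∧ b ] + [ a ∧ c ]
  []-∧-∨ false b     c = z≤n
  []-∧-∨ true  true  c = s≤s z≤n
  []-∧-∨ true  false c = ≤-refl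

  []-∧-≤ : ∀ {a b m} → (a ≡ true → b ≡ true → 1 ≤ m) → [ a ∧ b ] ≤ m
  []-∧-≤ {false}        _   = z≤n
  []-∧-≤ {true} {false} _   = z≤n
  []-∧-≤ {true} {true}  1≤m = 1≤m refl refl

  count-none : ∀ {k} (P : Fin k → Bool) → (∀ x → P x ≡ false) → count P ≡ 0
  count-none {k} P none = trans (sumF-cong (λ x → cong [_] (none x))) (sumF-zero {k})

  count≤1 : ∀ {k} (P : Fin k → Bool) → (∀ x y → P x ≡ true → P y ≡ true → x ≡ y) → count P ≤ 1
  count≤1 {zero}  P unique = z≤n
  count≤1 {suc k} P unique with P zero in P0
  ... | true  = s≤s (≤-reflexive (count-none (P ∘ suc) none))
    where
    none : ∀ x → P (suc x) ≡ false
    none x with P (suc x) in Px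
    ... | true  with () ← unique zero (suc x) P0 Px
    ... | false = refl
  ... | false = count≤1 (P ∘ suc) (λ x y Px Py → suc-injective (unique (suc x) (suc y) Px Py))

  exclusive⇒unique : ∀ {n k} (U : Fin k → VSet n) → (∀ i j v → i ≢ j → U i v ≡ true → U j v ≡ false) →
                     ∀ i j v → U i v ≡ true → U j v ≡ true → i ≡ j
  exclusive⇒unique U exclusive i j v Uᵢ Uⱼ with i ≟ᶠ j
  ... | yes i≡j = i≡j
  ... | no  i≢j with () ← trans (sym Uⱼ) (exclusive i j v i≢j Uᵢ)

  sumF-∣∣ᵥ-disjoint : ∀ {n k} (U : Fin k → VSet n) (W : VSet n) → (∀ a → U a ⊆ᵥ W) →
                      (∀ a b v → U a v ≡ true → U b v ≡ true → a ≡ b) →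
                      sumF (λ a → ∣ U a ∣ᵥ) ≤ ∣ W ∣ᵥ
  sumF-∣∣ᵥ-disjoint U W U⊆W disjoint =
    ≤-trans (≤-reflexive (sumF-comm (λ a v → [ U a v ]))) (sumF-mono-≤ at)
    where
    at : ∀ v → count (λ a → U a v) ≤ [ W v ]
    at v with W v in Wv
    ... | true  = count≤1 (λ a → U a v) (λ a b → disjoint a b v)
    ... | false = ≤-reflexive (count-none (λ a → U a v) outside)
      where
      outside : ∀ a → U a v ≡ false
      outside a with U a v in Uav
      ... | true  with () ← trans (sym (U⊆W a v Uav)) Wv
      ... | false = refl

  sumF-∣∣ᵥ≤n : ∀ {n k} (U : Fin k → VSet n) → (∀ a b v → U a v ≡ true → U b v ≡ true → a ≡ b) →
               sumF (λ a → ∣ U a ∣ᵥ) ≤ n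
  sumF-∣∣ᵥ≤n {n} U disjoint = subst (sumF (λ a → ∣ U a ∣ᵥ) ≤_) (trans (sumF-const {n} 1) (*-identityʳ n))
                                    (sumF-∣∣ᵥ-disjoint U (λ _ → true) (λ _ _ _ → refl) disjoint)

open FiniteSums

module PairSums where

  open import Data.Nat using (_+_; _*_; _≤_; z≤n; s≤s)
  open import Data.Nat.Properties
  open import Data.Fin.Properties using (toℕ-injective) renaming (_≟_ to _≟ᶠ_)
  open import Data.Bool.Properties using (∧-commutativeMonoid)
  open import Algebra.Bundles using (CommutativeMonoid)
  open import Algebra.Properties.CommutativeSemigroup
    (CommutativeMonoid.commutativeSemigroup ∧-commutativeMonoid) using (x∙yz≈y∙xz)

  module _ {n : ℕ} where

    sumPairs : (Fin n → Fin n → ℕ) → ℕ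
    sumPairs f = sumF λ x → sumF λ y → f x y

    sumPairs< : (Fin n → Fin n → ℕ) → ℕ
    sumPairs< f = sumPairs λ x y → [ toℕ x <ᵇ toℕ y ] * f x y

    sumPairs-cong : ∀ {f g : Fin n → Fin n → ℕ} → (∀ x y → f x y ≡ g x y) → sumPairs f ≡ sumPairs g
    sumPairs-cong f≗g = sumF-cong λ x → sumF-cong (f≗g x)

    sumPairs-mono-≤ : ∀ {f g : Fin n → Fin n → ℕ} → (∀ x y → f x y ≤ g x y) → sumPairs f ≤ sumPairs g
    sumPairs-mono-≤ f≤g = sumF-mono-≤ λ x → sumF-mono-≤ (f≤g x)

    sumPairs-distrib-+ : ∀ (f g : Fin n → Fin n → ℕ) →
                         sumPairs (λ x y → f x y + g x y) ≡ sumPairs f + sumPairs g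
    sumPairs-distrib-+ f g = trans (sumF-cong λ x → sumF-distrib-+ (f x) (g x))
                                   (sumF-distrib-+ (λ x → sumF (f x)) (λ x → sumF (g x)))

    *-distribˡ-sumPairs : ∀ c (f : Fin n → Fin n → ℕ) → c * sumPairs f ≡ sumPairs (λ x y → c * f x y)
    *-distribˡ-sumPairs c f = trans (*-distribˡ-sumF c (λ x → sumF (f x)))
                                    (sumF-cong λ x → *-distribˡ-sumF c (f x))

    *-distribʳ-sumPairs : ∀ c (f : Fin n → Fin n → ℕ) → sumPairs f * c ≡ sumPairs (λ x y → f x y * c)
    *-distribʳ-sumPairs c f = trans (*-distribʳ-sumF c (λ x → sumF (f x)))
                                    (sumF-cong λ x → *-distribʳ-sumF c (f x))

    sumF*sumF : ∀ (f g : Fin n → ℕ) → sumF f * sumF g ≡ sumPairs (λ x y → f x * g y)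
    sumF*sumF f g = trans (*-distribʳ-sumF (sumF g) f) (sumF-cong λ x → *-distribˡ-sumF (f x) g)

    sumPairs-transpose : ∀ (f : Fin n → Fin n → ℕ) → sumPairs (λ x y → f y x) ≡ sumPairs f
    sumPairs-transpose f = sumF-comm (λ x y → f y x)

    sumPairs<-∧ : ∀ (f : Fin n → Fin n → Bool) →
                  sumF (λ x → sumF (λ y → [ (toℕ x <ᵇ toℕ y) ∧ f x y ])) ≡ sumPairs< (λ x y → [ f x y ])
    sumPairs<-∧ f = sumPairs-cong λ x y → []-∧ (toℕ x <ᵇ toℕ y) (f x y)

    sumPairs-pull : ∀ {k} (f : Fin n → Fin n → Fin k → ℕ) →
                    sumPairs (λ x y → sumF (f x y)) ≡ sumF (λ i → sumPairs (λ x y → f x y i))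
    sumPairs-pull f = trans (sumF-cong λ x → sumF-comm (f x)) (sumF-comm (λ x i → sumF λ y → f x y i))

  [<ᵇ]+[>ᵇ]≤1 : ∀ m n → [ m <ᵇ n ] + [ n <ᵇ m ] ≤ 1
  [<ᵇ]+[>ᵇ]≤1 zero    zero    = z≤n
  [<ᵇ]+[>ᵇ]≤1 zero    (suc n) = s≤s z≤n
  [<ᵇ]+[>ᵇ]≤1 (suc m) zero    = s≤s z≤n
  [<ᵇ]+[>ᵇ]≤1 (suc m) (suc n) = [<ᵇ]+[>ᵇ]≤1 m n

  [<ᵇ]+[>ᵇ]≥1 : ∀ m n → m ≢ n → 1 ≤ [ m <ᵇ n ] + [ n <ᵇ m ]
  [<ᵇ]+[>ᵇ]≥1 zero    zero    m≢n = contradiction refl m≢n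
  [<ᵇ]+[>ᵇ]≥1 zero    (suc n) m≢n = s≤s z≤n
  [<ᵇ]+[>ᵇ]≥1 (suc m) zero    m≢n = s≤s z≤n
  [<ᵇ]+[>ᵇ]≥1 (suc m) (suc n) m≢n = [<ᵇ]+[>ᵇ]≥1 m n (m≢n ∘ cong suc)

  module _ {n : ℕ} {f : Fin n → Fin n → ℕ} (f-sym : ∀ x y → f x y ≡ f y x) where

    sumPairs-<+> : sumPairs (λ x y → ([ toℕ x <ᵇ toℕ y ] + [ toℕ y <ᵇ toℕ x ]) * f x y) ≡ 2 * sumPairs< f
    sumPairs-<+> = begin
      sumPairs (λ x y → ([ toℕ x <ᵇ toℕ y ] + [ toℕ y <ᵇ toℕ x ]) * f x y)
        ≡⟨ sumPairs-cong (λ x y → *-distribʳ-+ (f x y) [ toℕ x <ᵇ toℕ y ] _) ⟩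
      sumPairs (λ x y → [ toℕ x <ᵇ toℕ y ] * f x y + [ toℕ y <ᵇ toℕ x ] * f x y)
        ≡⟨ sumPairs-distrib-+ {n} _ _ ⟩
      sumPairs< f + sumPairs (λ x y → [ toℕ y <ᵇ toℕ x ] * f x y)
        ≡⟨ cong (sumPairs< f +_) (trans (sumPairs-cong λ x y → cong ([ toℕ y <ᵇ toℕ x ] *_) (f-sym x y))
                                        (sumPairs-transpose (λ x y → [ toℕ x <ᵇ toℕ y ] * f x y))) ⟩
      sumPairs< f + sumPairs< f
        ≡⟨ cong (sumPairs< f +_) (sym (+-identityʳ _)) ⟩
      2 * sumPairs< f ∎
      where open ≡-Reasoning

    2*sumPairs<≤sumPairs : 2 * sumPairs< f ≤ sumPairs f
    2*sumPairs<≤sumPairs = begin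
      2 * sumPairs< f  ≡⟨ sumPairs-<+> ⟨
      sumPairs (λ x y → ([ toℕ x <ᵇ toℕ y ] + [ toℕ y <ᵇ toℕ x ]) * f x y)
        ≤⟨ sumPairs-mono-≤ (λ x y → *-monoˡ-≤ (f x y) ([<ᵇ]+[>ᵇ]≤1 (toℕ x) (toℕ y))) ⟩
      sumPairs (λ x y → 1 * f x y) ≡⟨ sumPairs-cong (λ x y → *-identityˡ (f x y)) ⟩
      sumPairs f ∎
      where open ≤-Reasoning

    sumPairs≤2*sumPairs< : (∀ x → f x x ≡ 0) → sumPairs f ≤ 2 * sumPairs< f
    sumPairs≤2*sumPairs< f-diag = begin
      sumPairs f  ≤⟨ sumPairs-mono-≤ off-diagonal ⟩
      sumPairs (λ x y → ([ toℕ x <ᵇ toℕ y ] + [ toℕ y <ᵇ toℕ x ]) * f x y) ≡⟨ sumPairs-<+> ⟩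
      2 * sumPairs< f ∎
      where
      open ≤-Reasoning
      off-diagonal : ∀ x y → f x y ≤ ([ toℕ x <ᵇ toℕ y ] + [ toℕ y <ᵇ toℕ x ]) * f x y
      off-diagonal x y with x ≟ᶠ y
      ... | yes refl = ≤-trans (≤-reflexive (f-diag x)) z≤n
      ... | no  x≢y  = ≤-trans (≤-reflexive (sym (*-identityˡ (f x y))))
                               (*-monoˡ-≤ (f x y) ([<ᵇ]+[>ᵇ]≥1 (toℕ x) (toℕ y) (x≢y ∘ toℕ-injective)))

  module _ {n : ℕ} (G : Graph n) where

    eUW-comm : ∀ U W → eUW G U W ≡ eUW G W U
    eUW-comm U W = trans (sumPairs-cong λ x y → cong [_] (swap x y))
                         (sumPairs-transpose (λ x y → [ W x ∧ U y ∧ adj G x y ]))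
      where
      swap : ∀ x y → (U x ∧ W y ∧ adj G x y) ≡ (W y ∧ U x ∧ adj G y x)
      swap x y = trans (x∙yz≈y∙xz (U x) (W y) (adj G x y)) (cong (λ b → W y ∧ U x ∧ b) (adj-sym G x y))

    eUW≤∣∣*∣∣ : ∀ U W → eUW G U W ≤ ∣ U ∣ᵥ * ∣ W ∣ᵥ
    eUW≤∣∣*∣∣ U W = begin
      eUW G U W                            ≤⟨ sumPairs-mono-≤ at ⟩
      sumPairs (λ x y → [ U x ] * [ W y ]) ≡⟨ sumF*sumF (λ x → [ U x ]) (λ y → [ W y ]) ⟨
      ∣ U ∣ᵥ * ∣ W ∣ᵥ                      ∎
      where
      open ≤-Reasoning
      at : ∀ x y → [ U x ∧ W y ∧ adj G x y ] ≤ [ U x ] * [ W y ]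
      at x y = begin
        [ U x ∧ W y ∧ adj G x y ]           ≡⟨ trans ([]-∧ (U x) _) (cong ([ U x ] *_) ([]-∧ (W y) _)) ⟩
        [ U x ] * ([ W y ] * [ adj G x y ]) ≤⟨ *-monoʳ-≤ [ U x ] (*-monoʳ-≤ [ W y ] ([]≤1 (adj G x y))) ⟩
        [ U x ] * ([ W y ] * 1)             ≡⟨ cong ([ U x ] *_) (*-identityʳ [ W y ]) ⟩
        [ U x ] * [ W y ]                   ∎

    sumPairs-adj≤2*eG : sumPairs (λ x y → [ adj G x y ]) ≤ 2 * eG G
    sumPairs-adj≤2*eG = begin
      sumPairs (λ x y → [ adj G x y ])
        ≤⟨ sumPairs≤2*sumPairs< (λ x y → cong [_] (adj-sym G x y)) (λ x → cong [_] (irrefl G x)) ⟩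
      2 * sumPairs< (λ x y → [ adj G x y ]) ≡⟨ cong (2 *_) (sumPairs<-∧ (adj G)) ⟨
      2 * eG G ∎
      where open ≤-Reasoning

    sumPairs-adj*+ : ∀ (h : Fin n → ℕ) →
                     sumPairs (λ x y → [ adj G x y ] * (h x + h y)) ≡ 2 * sumF (λ x → deg G x * h x)
    sumPairs-adj*+ h = begin
      sumPairs (λ x y → [ adj G x y ] * (h x + h y))
        ≡⟨ sumPairs-cong (λ x y → *-distribˡ-+ [ adj G x y ] (h x) (h y)) ⟩
      sumPairs (λ x y → [ adj G x y ] * h x + [ adj G x y ] * h y)
        ≡⟨ sumPairs-distrib-+ (λ x y → [ adj G x y ] * h x) (λ x y → [ adj G x y ] * h y) ⟩
      sumPairs (λ x y → [ adj G x y ] * h x) + sumPairs (λ x y → [ adj G x y ] * h y)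
        ≡⟨ cong (sumPairs (λ x y → [ adj G x y ] * h x) +_)
                (trans (sumPairs-cong λ x y → cong (λ b → [ b ] * h y) (adj-sym G x y))
                       (sumPairs-transpose (λ x y → [ adj G x y ] * h x))) ⟩
      sumPairs (λ x y → [ adj G x y ] * h x) + sumPairs (λ x y → [ adj G x y ] * h x)
        ≡⟨ cong₂ _+_ degrees degrees ⟩
      D + D ≡⟨ cong (D +_) (sym (+-identityʳ D)) ⟩
      2 * D ∎
      where
      open ≡-Reasoning
      D = sumF (λ x → deg G x * h x)
      degrees : sumPairs (λ x y → [ adj G x y ] * h x) ≡ D
      degrees = sumF-cong λ x → sym (*-distribʳ-sumF (h x) (λ y → [ adj G x y ]))

    sumPairs-eUW-disjoint : ∀ {k} (U : Fin k → VSet n) → (∀ i j v → U i v ≡ true → U j v ≡ true → i ≡ j) →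
                            sumPairs (λ i j → eUW G (U i) (U j)) ≤ sumPairs (λ x y → [ adj G x y ])
    sumPairs-eUW-disjoint U disjoint = begin
      sumPairs (λ i j → eUW G (U i) (U j))
        ≡⟨ trans (sumF-cong λ i → sym (sumPairs-pull (λ x y j → [ U i x ∧ U j y ∧ adj G x y ])))
                 (sym (sumPairs-pull (λ x y i → sumF λ j → [ U i x ∧ U j y ∧ adj G x y ]))) ⟩
      sumPairs (λ x y → sumPairs (λ i j → [ U i x ∧ U j y ∧ adj G x y ])) ≤⟨ sumPairs-mono-≤ at ⟩
      sumPairs (λ x y → [ adj G x y ]) ∎
      where
      open ≤-Reasoning
      at : ∀ x y → sumPairs (λ i j → [ U i x ∧ U j y ∧ adj G x y ]) ≤ [ adj G x y ]
      at x y = begin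
        sumPairs (λ i j → [ U i x ∧ U j y ∧ adj G x y ])
          ≡⟨ sumPairs-cong (λ i j → trans ([]-∧ (U i x) _) (cong ([ U i x ] *_) ([]-∧ (U j y) _))) ⟩
        sumPairs (λ i j → [ U i x ] * ([ U j y ] * [ adj G x y ]))
          ≡⟨ sumF*sumF (λ i → [ U i x ]) (λ j → [ U j y ] * [ adj G x y ]) ⟨
        count (λ i → U i x) * sumF (λ j → [ U j y ] * [ adj G x y ])
          ≡⟨ cong (count (λ i → U i x) *_) (*-distribʳ-sumF [ adj G x y ] (λ j → [ U j y ])) ⟨
        count (λ i → U i x) * (count (λ j → U j y) * [ adj G x y ])
          ≤⟨ *-mono-≤ (count≤1 _ λ i j → disjoint i j x)
                      (*-monoˡ-≤ [ adj G x y ] (count≤1 _ λ i j → disjoint i j y)) ⟩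
        1 * (1 * [ adj G x y ]) ≡⟨ trans (*-identityˡ _) (*-identityˡ _) ⟩
        [ adj G x y ] ∎

open PairSums

module RationalCounts where

  open import Data.Integer as ℤ using (+_)
  import Data.Integer.Properties as ℤₚ
  open import Data.Rational using (_+_; _*_; _≤_; toℚᵘ)
  open import Data.Rational.Properties
  open import Data.Rational.Unnormalised as ℚᵘ using (mkℚᵘ; *≡*; *≤*)
  import Data.Rational.Unnormalised.Properties as ℚᵘₚ

  toℚᵘ-ℕ→ℚ : ∀ m → toℚᵘ (ℕ→ℚ m) ℚᵘ.≃ mkℚᵘ (+ m) 0
  toℚᵘ-ℕ→ℚ m = toℚᵘ-fromℚᵘ (mkℚᵘ (+ m) 0)

  ℕ→ℚ-+ : ∀ m n → ℕ→ℚ (m ℕ.+ n) ≡ ℕ→ℚ m + ℕ→ℚ n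
  ℕ→ℚ-+ m n = toℚᵘ-injective (begin
    toℚᵘ (ℕ→ℚ (m ℕ.+ n))              ≈⟨ toℚᵘ-ℕ→ℚ (m ℕ.+ n) ⟩
    mkℚᵘ (+ (m ℕ.+ n)) 0              ≈⟨ *≡* (cong (ℤ._* + 1) (cong₂ ℤ._+_ (sym (ℤₚ.*-identityʳ (+ m)))
                                                                            (sym (ℤₚ.*-identityʳ (+ n))))) ⟩
    mkℚᵘ (+ m) 0 ℚᵘ.+ mkℚᵘ (+ n) 0    ≈⟨ ℚᵘₚ.+-cong (toℚᵘ-ℕ→ℚ m) (toℚᵘ-ℕ→ℚ n) ⟨
    toℚᵘ (ℕ→ℚ m) ℚᵘ.+ toℚᵘ (ℕ→ℚ n)    ≈⟨ toℚᵘ-homo-+ (ℕ→ℚ m) (ℕ→ℚ n) ⟨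
    toℚᵘ (ℕ→ℚ m + ℕ→ℚ n)              ∎)
    where open ℚᵘₚ.≃-Reasoning

  ℕ→ℚ-* : ∀ m n → ℕ→ℚ (m ℕ.* n) ≡ ℕ→ℚ m * ℕ→ℚ n
  ℕ→ℚ-* m n = toℚᵘ-injective (begin
    toℚᵘ (ℕ→ℚ (m ℕ.* n))              ≈⟨ toℚᵘ-ℕ→ℚ (m ℕ.* n) ⟩
    mkℚᵘ (+ (m ℕ.* n)) 0              ≈⟨ *≡* (cong (ℤ._* + 1) (ℤₚ.pos-* m n)) ⟩
    mkℚᵘ (+ m) 0 ℚᵘ.* mkℚᵘ (+ n) 0    ≈⟨ ℚᵘₚ.*-cong (toℚᵘ-ℕ→ℚ m) (toℚᵘ-ℕ→ℚ n) ⟨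
    toℚᵘ (ℕ→ℚ m) ℚᵘ.* toℚᵘ (ℕ→ℚ n)    ≈⟨ toℚᵘ-homo-* (ℕ→ℚ m) (ℕ→ℚ n) ⟨
    toℚᵘ (ℕ→ℚ m * ℕ→ℚ n)              ∎)
    where open ℚᵘₚ.≃-Reasoning

  ℕ→ℚ-mono-≤ : ∀ {m n} → m ℕ.≤ n → ℕ→ℚ m ≤ ℕ→ℚ n
  ℕ→ℚ-mono-≤ {m} {n} m≤n = toℚᵘ-cancel-≤ (begin
    toℚᵘ (ℕ→ℚ m)  ≃⟨ toℚᵘ-ℕ→ℚ m ⟩
    mkℚᵘ (+ m) 0  ≤⟨ *≤* (ℤₚ.*-monoʳ-≤-nonNeg (+ 1) (ℤ.+≤+ m≤n)) ⟩
    mkℚᵘ (+ n) 0  ≃⟨ toℚᵘ-ℕ→ℚ n ⟨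
    toℚᵘ (ℕ→ℚ n)  ∎)
    where open ℚᵘₚ.≤-Reasoning

  0≤ℕ→ℚ : ∀ n → 0ℚ ≤ ℕ→ℚ n
  0≤ℕ→ℚ n = ℕ→ℚ-mono-≤ {0} {n} ℕ.z≤n

  *-monoˡ-≤-0≤ : ∀ {r p q} → 0ℚ ≤ r → p ≤ q → r * p ≤ r * q
  *-monoˡ-≤-0≤ {r} 0≤r = *-monoˡ-≤-nonNeg r {{ℚ.nonNegative 0≤r}}

  *-monoʳ-≤-0≤ : ∀ {r p q} → 0ℚ ≤ r → p ≤ q → p * r ≤ q * r
  *-monoʳ-≤-0≤ {r} 0≤r = *-monoʳ-≤-nonNeg r {{ℚ.nonNegative 0≤r}}

  0≤* : ∀ {p q} → 0ℚ ≤ p → 0ℚ ≤ q → 0ℚ ≤ p * q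
  0≤* {p} 0≤p 0≤q = ≤-trans (≤-reflexive (sym (*-zeroʳ p))) (*-monoˡ-≤-0≤ 0≤p 0≤q)

  ℕ→ℚ-sumF-≤ : ∀ {k} c (f g : Fin k → ℕ) → (∀ x → ℕ→ℚ (f x) ≤ c * ℕ→ℚ (g x)) →
               ℕ→ℚ (sumF f) ≤ c * ℕ→ℚ (sumF g)
  ℕ→ℚ-sumF-≤ {zero}  c f g f≤cg = ≤-reflexive (sym (*-zeroʳ c))
  ℕ→ℚ-sumF-≤ {suc k} c f g f≤cg = begin
    ℕ→ℚ (f zero ℕ.+ sumF (f ∘ suc))             ≡⟨ ℕ→ℚ-+ (f zero) _ ⟩
    ℕ→ℚ (f zero) + ℕ→ℚ (sumF (f ∘ suc))
      ≤⟨ +-mono-≤ (f≤cg zero) (ℕ→ℚ-sumF-≤ c (f ∘ suc) (g ∘ suc) (f≤cg ∘ suc)) ⟩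
    c * ℕ→ℚ (g zero) + c * ℕ→ℚ (sumF (g ∘ suc)) ≡⟨ *-distribˡ-+ c _ _ ⟨
    c * (ℕ→ℚ (g zero) + ℕ→ℚ (sumF (g ∘ suc)))   ≡⟨ cong (c *_) (ℕ→ℚ-+ (g zero) _) ⟨
    c * ℕ→ℚ (g zero ℕ.+ sumF (g ∘ suc))         ∎
    where open ≤-Reasoning

  ℕ→ℚ-sumF-≥ : ∀ {k} c (f g : Fin k → ℕ) → (∀ x → c * ℕ→ℚ (f x) ≤ ℕ→ℚ (g x)) →
               c * ℕ→ℚ (sumF f) ≤ ℕ→ℚ (sumF g)
  ℕ→ℚ-sumF-≥ {zero}  c f g cf≤g = ≤-reflexive (*-zeroʳ c)
  ℕ→ℚ-sumF-≥ {suc k} c f g cf≤g = begin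
    c * ℕ→ℚ (f zero ℕ.+ sumF (f ∘ suc))         ≡⟨ cong (c *_) (ℕ→ℚ-+ (f zero) _) ⟩
    c * (ℕ→ℚ (f zero) + ℕ→ℚ (sumF (f ∘ suc)))   ≡⟨ *-distribˡ-+ c _ _ ⟩
    c * ℕ→ℚ (f zero) + c * ℕ→ℚ (sumF (f ∘ suc))
      ≤⟨ +-mono-≤ (cf≤g zero) (ℕ→ℚ-sumF-≥ c (f ∘ suc) (g ∘ suc) (cf≤g ∘ suc)) ⟩
    ℕ→ℚ (g zero) + ℕ→ℚ (sumF (g ∘ suc))         ≡⟨ ℕ→ℚ-+ (g zero) _ ⟨
    ℕ→ℚ (g zero ℕ.+ sumF (g ∘ suc))             ∎
    where open ≤-Reasoning

  ℕ→ℚ-sumF-*-≤ : ∀ {k} c (f h : Fin k → ℕ) → (∀ x → ℕ→ℚ (f x) ≤ c) →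
                 ℕ→ℚ (sumF (λ x → f x ℕ.* h x)) ≤ c * ℕ→ℚ (sumF h)
  ℕ→ℚ-sumF-*-≤ c f h f≤c = ℕ→ℚ-sumF-≤ c (λ x → f x ℕ.* h x) h λ x →
    ≤-trans (≤-reflexive (ℕ→ℚ-* (f x) (h x))) (*-monoʳ-≤-0≤ (0≤ℕ→ℚ (h x)) (f≤c x))

  ℕ→ℚ-[]*-≤ : ∀ c b m n → (b ≡ true → ℕ→ℚ m ≤ c * ℕ→ℚ n) → ℕ→ℚ ([ b ] ℕ.* m) ≤ c * ℕ→ℚ ([ b ] ℕ.* n)
  ℕ→ℚ-[]*-≤ c false m n _    = ≤-reflexive (sym (*-zeroʳ c))
  ℕ→ℚ-[]*-≤ c true  m n m≤cn = subst₂ (λ m′ n′ → ℕ→ℚ m′ ≤ c * ℕ→ℚ n′)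
                                      (sym (ℕₚ.+-identityʳ m)) (sym (ℕₚ.+-identityʳ n)) (m≤cn refl)

  ℕ→ℚ-[]*-≥ : ∀ c b m n → (b ≡ true → c * ℕ→ℚ n ≤ ℕ→ℚ m) → c * ℕ→ℚ ([ b ] ℕ.* n) ≤ ℕ→ℚ ([ b ] ℕ.* m)
  ℕ→ℚ-[]*-≥ c false m n _    = ≤-reflexive (*-zeroʳ c)
  ℕ→ℚ-[]*-≥ c true  m n cn≤m = subst₂ (λ m′ n′ → c * ℕ→ℚ n′ ≤ ℕ→ℚ m′)
                                      (sym (ℕₚ.+-identityʳ m)) (sym (ℕₚ.+-identityʳ n)) (cn≤m refl)

  -- dens with its case split on |U||W| made a function of its own, so that it can be rewritten.
  densityOf : (pairs edges : ℕ) → ℚ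
  densityOf zero    e = 0ℚ
  densityOf (suc d) e = + e ℚ./ suc d

  densityOf-*-pairs : ∀ d e → densityOf (suc d) e * ℕ→ℚ (suc d) ≡ ℕ→ℚ e
  densityOf-*-pairs d e = toℚᵘ-injective (begin
    toℚᵘ (densityOf (suc d) e * ℕ→ℚ (suc d))
      ≈⟨ toℚᵘ-homo-* (densityOf (suc d) e) (ℕ→ℚ (suc d)) ⟩
    toℚᵘ (densityOf (suc d) e) ℚᵘ.* toℚᵘ (ℕ→ℚ (suc d))
      ≈⟨ ℚᵘₚ.*-cong (toℚᵘ-fromℚᵘ (mkℚᵘ (+ e) d)) (toℚᵘ-ℕ→ℚ (suc d)) ⟩
    mkℚᵘ (+ e) d ℚᵘ.* mkℚᵘ (+ suc d) 0
      ≈⟨ *≡* (trans (ℤₚ.*-identityʳ _) (cong (λ t → + e ℤ.* + t) (sym (ℕₚ.*-identityʳ (suc d))))) ⟩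
    mkℚᵘ (+ e) 0   ≈⟨ toℚᵘ-ℕ→ℚ e ⟨
    toℚᵘ (ℕ→ℚ e)   ∎)
    where open ℚᵘₚ.≃-Reasoning

  dens≡densityOf : ∀ {n} (G : Graph n) U W → dens G U W ≡ densityOf (∣ U ∣ᵥ ℕ.* ∣ W ∣ᵥ) (eUW G U W)
  dens≡densityOf G U W with ∣ U ∣ᵥ ℕ.* ∣ W ∣ᵥ
  ... | zero  = refl
  ... | suc d = refl

  dens-comm : ∀ {n} (G : Graph n) U W → dens G U W ≡ dens G W U
  dens-comm G U W = begin
    dens G U W                                ≡⟨ dens≡densityOf G U W ⟩
    densityOf (∣ U ∣ᵥ ℕ.* ∣ W ∣ᵥ) (eUW G U W)  ≡⟨ cong₂ densityOf (ℕₚ.*-comm ∣ U ∣ᵥ ∣ W ∣ᵥ) (eUW-comm G U W) ⟩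
    densityOf (∣ W ∣ᵥ ℕ.* ∣ U ∣ᵥ) (eUW G W U)  ≡⟨ dens≡densityOf G W U ⟨
    dens G W U                                ∎
    where open ≡-Reasoning

  ≤densityOf⇒ : ∀ c d e → c ≤ densityOf d e → c * ℕ→ℚ d ≤ ℕ→ℚ e
  ≤densityOf⇒ c zero    e _   = subst (_≤ ℕ→ℚ e) (sym (*-zeroʳ c)) (0≤ℕ→ℚ e)
  ≤densityOf⇒ c (suc d) e c≤ρ = subst (c * ℕ→ℚ (suc d) ≤_) (densityOf-*-pairs d e)
                                      (*-monoʳ-≤-0≤ (0≤ℕ→ℚ (suc d)) c≤ρ)

  densityOf≤⇒ : ∀ c d e → e ℕ.≤ d → densityOf d e ≤ c → ℕ→ℚ e ≤ c * ℕ→ℚ d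
  densityOf≤⇒ c zero    e e≤0 _   rewrite ℕₚ.n≤0⇒n≡0 e≤0 = ≤-reflexive (sym (*-zeroʳ c))
  densityOf≤⇒ c (suc d) e _   ρ≤c = subst (_≤ c * ℕ→ℚ (suc d)) (densityOf-*-pairs d e)
                                          (*-monoʳ-≤-0≤ (0≤ℕ→ℚ (suc d)) ρ≤c)

  module _ {n : ℕ} (G : Graph n) (U W : VSet n) (c : ℚ) where

    ≤dens⇒≤eUW : c ≤ dens G U W → c * ℕ→ℚ (∣ U ∣ᵥ ℕ.* ∣ W ∣ᵥ) ≤ ℕ→ℚ (eUW G U W)
    ≤dens⇒≤eUW c≤d = ≤densityOf⇒ c (∣ U ∣ᵥ ℕ.* ∣ W ∣ᵥ) (eUW G U W) (subst (c ≤_) (dens≡densityOf G U W) c≤d)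

    dens≤⇒eUW≤ : dens G U W ≤ c → ℕ→ℚ (eUW G U W) ≤ c * ℕ→ℚ (∣ U ∣ᵥ ℕ.* ∣ W ∣ᵥ)
    dens≤⇒eUW≤ d≤c = densityOf≤⇒ c (∣ U ∣ᵥ ℕ.* ∣ W ∣ᵥ) (eUW G U W) (eUW≤∣∣*∣∣ G U W)
                                   (subst (_≤ c) (dens≡densityOf G U W) d≤c)

  ≤dens⇒≤2*eG : ∀ {n ℓ} (H : Graph n) (F : Graph ℓ) (W : Fin ℓ → VSet n) (c : ℚ) →
    (∀ i j v → W i v ≡ true → W j v ≡ true → i ≡ j) → (∀ i j → adj F i j ≡ true → c ≤ dens H (W i) (W j)) →
    c * ℕ→ℚ (sumPairs (λ i j → [ adj F i j ] ℕ.* (∣ W i ∣ᵥ ℕ.* ∣ W j ∣ᵥ))) ≤ ℕ→ℚ 2 * ℕ→ℚ (eG H)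
  ≤dens⇒≤2*eG H F W c W-disjoint dense = begin
    c * ℕ→ℚ (sumPairs (λ i j → [ adj F i j ] ℕ.* (∣ W i ∣ᵥ ℕ.* ∣ W j ∣ᵥ)))
      ≤⟨ ℕ→ℚ-sumF-≥ c _ _ (λ i → ℕ→ℚ-sumF-≥ c _ _ λ j → ℕ→ℚ-[]*-≥ c (adj F i j) _ _
           λ Fij → ≤dens⇒≤eUW H (W i) (W j) c (dense i j Fij)) ⟩
    ℕ→ℚ (sumPairs (λ i j → [ adj F i j ] ℕ.* eUW H (W i) (W j)))
      ≤⟨ ℕ→ℚ-mono-≤ (sumPairs-mono-≤ λ i j → ℕₚ.≤-trans (ℕₚ.*-monoˡ-≤ (eUW H (W i) (W j)) ([]≤1 (adj F i j)))
                                                         (ℕₚ.≤-reflexive (ℕₚ.*-identityˡ (eUW H (W i) (W j))))) ⟩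
    ℕ→ℚ (sumPairs (λ i j → eUW H (W i) (W j)))
      ≤⟨ ℕ→ℚ-mono-≤ (ℕₚ.≤-trans (sumPairs-eUW-disjoint H W W-disjoint) (sumPairs-adj≤2*eG H)) ⟩
    ℕ→ℚ (2 ℕ.* eG H) ≡⟨ ℕ→ℚ-* 2 (eG H) ⟩
    ℕ→ℚ 2 * ℕ→ℚ (eG H) ∎
    where open ≤-Reasoning

open RationalCounts

module ClusterSums {ℓ : ℕ} (p : Fin ℓ → ℕ) where

  open import Data.Nat using (_+_; _*_; _≤_)
  open import Data.Nat.Properties

  sumCl : ((i : Fin ℓ) → Fin (p i) → ℕ) → ℕ
  sumCl f = sumF λ i → sumF λ a → f i a

  sumCl-cong : ∀ {f g : (i : Fin ℓ) → Fin (p i) → ℕ} → (∀ i a → f i a ≡ g i a) → sumCl f ≡ sumCl g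
  sumCl-cong f≗g = sumF-cong λ i → sumF-cong (f≗g i)

  sumCl-mono-≤ : ∀ {f g : (i : Fin ℓ) → Fin (p i) → ℕ} → (∀ i a → f i a ≤ g i a) → sumCl f ≤ sumCl g
  sumCl-mono-≤ f≤g = sumF-mono-≤ λ i → sumF-mono-≤ (f≤g i)

  *-distribʳ-sumCl : ∀ c (f : (i : Fin ℓ) → Fin (p i) → ℕ) → sumCl f * c ≡ sumCl (λ i a → f i a * c)
  *-distribʳ-sumCl c f = trans (*-distribʳ-sumF c (λ i → sumF (f i)))
                               (sumF-cong λ i → *-distribʳ-sumF c (f i))

  sumCl-distrib-+ : ∀ (f g : (i : Fin ℓ) → Fin (p i) → ℕ) →
                    sumCl (λ i a → f i a + g i a) ≡ sumCl f + sumCl g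
  sumCl-distrib-+ f g = trans (sumF-cong λ i → sumF-distrib-+ (f i) (g i))
                              (sumF-distrib-+ (λ i → sumF (f i)) (λ i → sumF (g i)))

  term≤sumCl : ∀ (f : (i : Fin ℓ) → Fin (p i) → ℕ) i a → f i a ≤ sumCl f
  term≤sumCl f i a = ≤-trans (term≤sumF (f i) a) (term≤sumF (λ i → sumF (f i)) i)

  sumF-sumCl-comm : ∀ {k} (f : Fin k → (i : Fin ℓ) → Fin (p i) → ℕ) →
                    sumF (λ x → sumCl (f x)) ≡ sumCl (λ i a → sumF (λ x → f x i a))
  sumF-sumCl-comm f = trans (sumF-comm (λ x i → sumF (f x i))) (sumF-cong λ i → sumF-comm (λ x → f x i))

  sumCl-comm : ∀ (f : (i : Fin ℓ) → Fin (p i) → (j : Fin ℓ) → Fin (p j) → ℕ) →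
               sumCl (λ i a → sumCl (f i a)) ≡ sumCl (λ j b → sumCl (λ i a → f i a j b))
  sumCl-comm f = trans (sumF-cong λ i → sumF-sumCl-comm (f i))
                       (sumF-sumCl-comm (λ i j b → sumF λ a → f i a j b))

  sumCl²-const : ∀ (f : Fin ℓ → Fin ℓ → ℕ) →
                 sumCl (λ i _ → sumCl (λ j _ → f i j)) ≡ sumPairs (λ i j → f i j * (p i * p j))
  sumCl²-const f = begin
    sumCl (λ i _ → sumCl (λ j _ → f i j))
      ≡⟨ sumF-cong (λ i → sumF-const {p i} (sumF λ j → sumF {p j} λ _ → f i j)) ⟩
    sumF (λ i → p i * sumF λ j → sumF {p j} λ _ → f i j)
      ≡⟨ sumF-cong (λ i → cong (p i *_) (sumF-cong λ j → sumF-const {p j} (f i j))) ⟩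
    sumF (λ i → p i * sumF λ j → p j * f i j)
      ≡⟨ sumF-cong (λ i → *-distribˡ-sumF (p i) (λ j → p j * f i j)) ⟩
    sumPairs (λ i j → p i * (p j * f i j))
      ≡⟨ sumPairs-cong (λ i j → trans (sym (*-assoc (p i) (p j) (f i j))) (*-comm (p i * p j) (f i j))) ⟩
    sumPairs (λ i j → f i j * (p i * p j)) ∎
    where open ≡-Reasoning

  sumPairs-sumCl²-comm : ∀ {n} (f : Fin n → Fin n → (i : Fin ℓ) → Fin (p i) → (j : Fin ℓ) → Fin (p j) → ℕ) →
    sumPairs (λ x y → sumCl (λ i a → sumCl (f x y i a))) ≡
    sumCl (λ i a → sumCl (λ j b → sumPairs (λ x y → f x y i a j b)))
  sumPairs-sumCl²-comm f = begin
    sumF (λ x → sumF λ y → sumCl λ i a → sumCl (f x y i a))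
      ≡⟨ sumF-cong (λ x → sumF-sumCl-comm (λ y i a → sumCl (f x y i a))) ⟩
    sumF (λ x → sumCl λ i a → sumF λ y → sumCl (f x y i a))
      ≡⟨ sumF-cong (λ x → sumCl-cong λ i a → sumF-sumCl-comm (λ y → f x y i a)) ⟩
    sumF (λ x → sumCl λ i a → sumCl λ j b → sumF λ y → f x y i a j b)
      ≡⟨ sumF-sumCl-comm (λ x i a → sumCl λ j b → sumF λ y → f x y i a j b) ⟩
    sumCl (λ i a → sumF λ x → sumCl λ j b → sumF λ y → f x y i a j b)
      ≡⟨ sumCl-cong (λ i a → sumF-sumCl-comm (λ x j b → sumF λ y → f x y i a j b)) ⟩
    sumCl (λ i a → sumCl λ j b → sumPairs λ x y → f x y i a j b) ∎
    where open ≡-Reasoning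


common-value : ∀ {ℓ} {p : Fin ℓ → ℕ} (f : (i : Fin ℓ) → Fin (p i) → ℕ) →
               (∀ i j a b → f i a ≡ f j b) → ∃[ s ] ∀ i a → f i a ≡ s
common-value {p = p} f f-const with any? (λ i → 0 ℕ.<? p i)
... | yes (i , 0<pᵢ) = f i (fromℕ< 0<pᵢ) , λ j b → f-const j i b (fromℕ< 0<pᵢ)
... | no  empty      = 0 , λ i a → contradiction (i , ℕₚ.≤-<-trans ℕ.z≤n (toℕ<n a)) empty

-- P i zero is the exceptional set W_i^(0) and P i (suc a) is the cluster W_i^(a+1).
module ClusterPairs {n ℓ : ℕ} (H : Graph n) (F : Graph ℓ) {p : Fin ℓ → ℕ}
                    (P : (i : Fin ℓ) → Fin (suc (p i)) → VSet n) where

  open import Data.Nat using (_+_; _*_; _≤_)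
  open import Data.Nat.Properties hiding (suc-injective)
  open import Data.Nat.Solver using (module +-*-Solver)
  open +-*-Solver using (solve; _:*_; _:=_)
  open import Data.Fin.Properties using (suc-injective)
  open import Data.Bool.Properties using (∧-commutativeMonoid) renaming (_≟_ to _≟ᵇ_)
  open import Algebra.Bundles using (CommutativeMonoid)
  open import Algebra.Properties.CommutativeSemigroup
    (CommutativeMonoid.commutativeSemigroup ∧-commutativeMonoid) using (x∙yz≈y∙xz)
  open import Relation.Nullary using (_×-dec_)
  open ClusterSums p

  PairFlag : Set
  PairFlag = (i : Fin ℓ) → Fin (p i) → (j : Fin ℓ) → Fin (p j) → Bool

  _∨ᶠ_ : PairFlag → PairFlag → PairFlag
  (g ∨ᶠ g′) i a j b = g i a j b ∨ g′ i a j b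

  exceptional : Fin n → ℕ
  exceptional x = count λ i → P i zero x

  clusterPairs : ℕ
  clusterPairs = sumPairs λ i j → [ adj F i j ] * (p i * p j)

  flaggedPairs : PairFlag → ℕ
  flaggedPairs g = sumCl λ i a → sumCl λ j b → [ adj F i j ∧ g i a j b ]

  flaggedEdges : PairFlag → Fin n → Fin n → ℕ
  flaggedEdges g x y = sumCl λ i a → sumCl λ j b →
    [ adj F i j ∧ g i a j b ] * [ P i (suc a) x ∧ P j (suc b) y ∧ adj H x y ]

  InUnflaggedPair : PairFlag → Fin n → Fin n → Set
  InUnflaggedPair g x y = ∃[ i ] ∃[ a ] ∃[ j ] ∃[ b ]
    (adj F i j ≡ true × P i (suc a) x ≡ true × P j (suc b) y ≡ true × g i a j b ≡ false)

  inUnflaggedPair? : ∀ g x y → Dec (InUnflaggedPair g x y)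
  inUnflaggedPair? g x y = any? λ i → any? λ a → any? λ j → any? λ b →
    adj F i j ≟ᵇ true ×-dec P i (suc a) x ≟ᵇ true ×-dec P j (suc b) y ≟ᵇ true ×-dec g i a j b ≟ᵇ false

  EdgesAlongF : Set
  EdgesAlongF = ∀ x y → adj H x y ≡ true →
    ∃[ i ] ∃[ a ] ∃[ j ] ∃[ b ] (adj F i j ≡ true × P i a x ≡ true × P j b y ≡ true)

  edgesAlongF : (W : Fin ℓ → VSet n) →
    (∀ x y → adj H x y ≡ true → ∃[ i ] ∃[ j ] (adj F i j ≡ true × W i x ≡ true × W j y ≡ true)) →
    (∀ i v → W i v ≡ true → ∃[ a ] P i a v ≡ true) → EdgesAlongF
  edgesAlongF W edges-in-W W⊆P x y Hxy with edges-in-W x y Hxy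
  ... | i , j , Fij , Wᵢx , Wⱼy with W⊆P i x Wᵢx | W⊆P j y Wⱼy
  ...   | a , Pᵢₐx | b , Pⱼᵦy = i , a , j , b , Fij , Pᵢₐx , Pⱼᵦy

  exceptional-≥1 : ∀ {x} i → P i zero x ≡ true → 1 ≤ exceptional x
  exceptional-≥1 {x} i Px = subst (_≤ exceptional x) (cong [_] Px) (term≤sumF (λ i → [ P i zero x ]) i)

  sumF-exceptional : sumF exceptional ≡ sumF (λ i → ∣ P i zero ∣ᵥ)
  sumF-exceptional = sumF-comm (λ x i → [ P i zero x ])

  flaggedEdges-≥1 : ∀ g {x y} i a j b → adj F i j ≡ true → g i a j b ≡ true →
                    P i (suc a) x ≡ true → P j (suc b) y ≡ true → adj H x y ≡ true → 1 ≤ flaggedEdges g x y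
  flaggedEdges-≥1 g {x} {y} i a j b Fij gᵢₐⱼᵦ Pᵢₐx Pⱼᵦy Hxy = begin
    1                  ≡⟨ one ⟩
    e i a j b          ≤⟨ term≤sumCl (e i a) j b ⟩
    sumCl (e i a)      ≤⟨ term≤sumCl (λ i a → sumCl (e i a)) i a ⟩
    flaggedEdges g x y ∎
    where
    open ≤-Reasoning
    e : (i : Fin ℓ) → Fin (p i) → (j : Fin ℓ) → Fin (p j) → ℕ
    e i a j b = [ adj F i j ∧ g i a j b ] * [ P i (suc a) x ∧ P j (suc b) y ∧ adj H x y ]
    one : 1 ≡ e i a j b
    one rewrite Fij | gᵢₐⱼᵦ | Pᵢₐx | Pⱼᵦy | Hxy = refl

  uncovered⇒1≤exceptional+flagged : EdgesAlongF → ∀ g x y → adj H x y ≡ true → ¬ InUnflaggedPair g x y →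
                                    1 ≤ exceptional x + exceptional y + flaggedEdges g x y
  uncovered⇒1≤exceptional+flagged along g x y Hxy uncovered with along x y Hxy
  ... | i , zero , j , _ , _ , Pᵢ₀x , _ =
    ≤-trans (exceptional-≥1 i Pᵢ₀x) (≤-trans (m≤m+n _ (exceptional y)) (m≤m+n _ (flaggedEdges g x y)))
  ... | i , suc a , j , zero , _ , _ , Pⱼ₀y =
    ≤-trans (exceptional-≥1 j Pⱼ₀y) (≤-trans (m≤n+m _ (exceptional x)) (m≤m+n _ (flaggedEdges g x y)))
  ... | i , suc a , j , suc b , Fij , Pᵢₐx , Pⱼᵦy with g i a j b in gᵢₐⱼᵦ
  ...   | true  = ≤-trans (flaggedEdges-≥1 g i a j b Fij gᵢₐⱼᵦ Pᵢₐx Pⱼᵦy Hxy)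
                          (m≤n+m _ (exceptional x + exceptional y))
  ...   | false = contradiction (i , a , j , b , Fij , Pᵢₐx , Pⱼᵦy , gᵢₐⱼᵦ) uncovered

  flaggedEdges-∨ᶠ : ∀ g g′ x y → flaggedEdges (g ∨ᶠ g′) x y ≤ flaggedEdges g x y + flaggedEdges g′ x y
  flaggedEdges-∨ᶠ g g′ x y = begin
    flaggedEdges (g ∨ᶠ g′) x y
      ≤⟨ sumCl-mono-≤ (λ i a → sumCl-mono-≤ λ j b → ≤-trans
           (*-monoˡ-≤ (e i a j b) ([]-∧-∨ (adj F i j) (g i a j b) (g′ i a j b)))
           (≤-reflexive (*-distribʳ-+ (e i a j b) [ adj F i j ∧ g i a j b ] _))) ⟩
    sumCl (λ i a → sumCl λ j b → f g i a j b + f g′ i a j b)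
      ≡⟨ trans (sumCl-cong λ i a → sumCl-distrib-+ (f g i a) (f g′ i a))
               (sumCl-distrib-+ (λ i a → sumCl (f g i a)) (λ i a → sumCl (f g′ i a))) ⟩
    flaggedEdges g x y + flaggedEdges g′ x y ∎
    where
    open ≤-Reasoning
    e : (i : Fin ℓ) → Fin (p i) → (j : Fin ℓ) → Fin (p j) → ℕ
    e i a j b = [ P i (suc a) x ∧ P j (suc b) y ∧ adj H x y ]
    f : PairFlag → (i : Fin ℓ) → Fin (p i) → (j : Fin ℓ) → Fin (p j) → ℕ
    f g i a j b = [ adj F i j ∧ g i a j b ] * e i a j b

  flaggedEdges-comm : ∀ g → (∀ i a j b → g i a j b ≡ g j b i a) →
                      ∀ x y → flaggedEdges g x y ≡ flaggedEdges g y x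
  flaggedEdges-comm g g-sym x y = trans
    (sumCl-cong λ i a → sumCl-cong λ j b → cong₂ _*_
      (cong [_] (cong₂ _∧_ (adj-sym F i j) (g-sym i a j b)))
      (cong [_] (trans (x∙yz≈y∙xz (P i (suc a) x) (P j (suc b) y) (adj H x y))
                       (cong (λ e → P j (suc b) y ∧ P i (suc a) x ∧ e) (adj-sym H x y)))))
    (sym (sumCl-comm (λ j b i a → [ adj F j i ∧ g j b i a ] * [ P j (suc b) y ∧ P i (suc a) x ∧ adj H y x ])))

  sumPairs-flaggedEdges : ∀ g → sumPairs (flaggedEdges g) ≡
    sumCl (λ i a → sumCl λ j b → [ adj F i j ∧ g i a j b ] * eUW H (P i (suc a)) (P j (suc b)))
  sumPairs-flaggedEdges g = trans
    (sumPairs-sumCl²-comm λ x y i a j b →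
      [ adj F i j ∧ g i a j b ] * [ P i (suc a) x ∧ P j (suc b) y ∧ adj H x y ])
    (sumCl-cong λ i a → sumCl-cong λ j b →
      sym (*-distribˡ-sumPairs [ adj F i j ∧ g i a j b ] (λ x y → [ P i (suc a) x ∧ P j (suc b) y ∧ adj H x y ])))

  -- The g′ part is symmetrised by hand: g′ need not be symmetric, which costs a factor 2 on its total.
  charge : PairFlag → PairFlag → Fin n → Fin n → ℕ
  charge g g′ x y = [ adj H x y ] * (exceptional x + exceptional y) + flaggedEdges g x y
                  + (flaggedEdges g′ x y + flaggedEdges g′ y x)

  charge-comm : ∀ g g′ → (∀ i a j b → g i a j b ≡ g j b i a) → ∀ x y → charge g g′ x y ≡ charge g g′ y x
  charge-comm g g′ g-sym x y = cong₂ _+_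
    (cong₂ _+_ (cong₂ _*_ (cong [_] (adj-sym H x y)) (+-comm (exceptional x) _)) (flaggedEdges-comm g g-sym x y))
    (+-comm (flaggedEdges g′ x y) _)

  sumPairs-charge : ∀ g g′ → sumPairs (charge g g′) ≡
    2 * sumF (λ x → deg H x * exceptional x) + sumPairs (flaggedEdges g) + 2 * sumPairs (flaggedEdges g′)
  sumPairs-charge g g′ = begin
    sumPairs (charge g g′)
      ≡⟨ trans (sumPairs-distrib-+ {n} _ _)
               (cong₂ _+_ (sumPairs-distrib-+ {n} _ _) (sumPairs-distrib-+ {n} _ _)) ⟩
    sumPairs (λ x y → [ adj H x y ] * (exceptional x + exceptional y)) + T
      + (T′ + sumPairs (λ x y → flaggedEdges g′ y x))
      ≡⟨ cong₂ (λ m m′ → m + T + (T′ + m′)) (sumPairs-adj*+ H exceptional) (sumPairs-transpose (flaggedEdges g′)) ⟩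
    2 * D + T + (T′ + T′) ≡⟨ cong (λ m → 2 * D + T + (T′ + m)) (sym (+-identityʳ T′)) ⟩
    2 * D + T + 2 * T′ ∎
    where
    open ≡-Reasoning
    D T T′ : ℕ
    D = sumF (λ x → deg H x * exceptional x)
    T = sumPairs (flaggedEdges g)
    T′ = sumPairs (flaggedEdges g′)

  uncovered⇒1≤charge : EdgesAlongF → ∀ g g′ x y → adj H x y ≡ true → ¬ InUnflaggedPair (g ∨ᶠ g′) x y →
                       1 ≤ charge g g′ x y
  uncovered⇒1≤charge along g g′ x y Hxy uncovered = begin
    1                                              ≤⟨ uncovered⇒1≤exceptional+flagged along _ x y Hxy uncovered ⟩
    E + flaggedEdges (g ∨ᶠ g′) x y                 ≤⟨ +-monoʳ-≤ E (flaggedEdges-∨ᶠ g g′ x y) ⟩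
    E + (flaggedEdges g x y + flaggedEdges g′ x y) ≡⟨ +-assoc E _ _ ⟨
    E + flaggedEdges g x y + flaggedEdges g′ x y
      ≤⟨ +-monoʳ-≤ (E + flaggedEdges g x y) (m≤m+n _ (flaggedEdges g′ y x)) ⟩
    E + flaggedEdges g x y + (flaggedEdges g′ x y + flaggedEdges g′ y x)
      ≡⟨ cong (λ m → m + flaggedEdges g x y + (flaggedEdges g′ x y + flaggedEdges g′ y x))
              (trans (sym (*-identityˡ E)) (cong (λ b → [ b ] * E) (sym Hxy))) ⟩
    charge g g′ x y ∎
    where
    open ≤-Reasoning
    E : ℕ
    E = exceptional x + exceptional y

  uncovered-edges≤ : EdgesAlongF → ∀ g g′ → (∀ i a j b → g i a j b ≡ g j b i a) →
    (B : Fin n → Fin n → Bool) → (∀ x y → B x y ≡ true → ¬ InUnflaggedPair (g ∨ᶠ g′) x y) →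
    2 * sumPairs< (λ x y → [ adj H x y ∧ B x y ]) ≤
    2 * sumF (λ x → deg H x * exceptional x) + sumPairs (flaggedEdges g) + 2 * sumPairs (flaggedEdges g′)
  uncovered-edges≤ along g g′ g-sym B uncovered = begin
    2 * sumPairs< (λ x y → [ adj H x y ∧ B x y ])
      ≤⟨ *-monoʳ-≤ 2 (sumPairs-mono-≤ λ x y → *-monoʳ-≤ [ toℕ x <ᵇ toℕ y ]
           ([]-∧-≤ λ Hxy Bxy → uncovered⇒1≤charge along g g′ x y Hxy (uncovered x y Bxy))) ⟩
    2 * sumPairs< (charge g g′) ≤⟨ 2*sumPairs<≤sumPairs (charge-comm g g′ g-sym) ⟩
    sumPairs (charge g g′)      ≡⟨ sumPairs-charge g g′ ⟩
    2 * sumF (λ x → deg H x * exceptional x) + sumPairs (flaggedEdges g) + 2 * sumPairs (flaggedEdges g′) ∎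
    where open ≤-Reasoning

  module _ (s : ℕ) (size : ∀ i a → ∣ P i (suc a) ∣ᵥ ≡ s) where

    sumPairs-flaggedEdges≤ : ∀ g → sumPairs (flaggedEdges g) ≤ flaggedPairs g * (s * s)
    sumPairs-flaggedEdges≤ g = begin
      sumPairs (flaggedEdges g) ≡⟨ sumPairs-flaggedEdges g ⟩
      sumCl (λ i a → sumCl λ j b → [ adj F i j ∧ g i a j b ] * eUW H (P i (suc a)) (P j (suc b)))
        ≤⟨ sumCl-mono-≤ (λ i a → sumCl-mono-≤ λ j b → *-monoʳ-≤ [ adj F i j ∧ g i a j b ]
             (subst₂ (λ m m′ → _ ≤ m * m′) (size i a) (size j b) (eUW≤∣∣*∣∣ H _ _))) ⟩
      sumCl (λ i a → sumCl λ j b → [ adj F i j ∧ g i a j b ] * (s * s))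
        ≡⟨ trans (sumCl-cong λ i a → sym (*-distribʳ-sumCl (s * s) (λ j b → [ adj F i j ∧ g i a j b ])))
                 (sym (*-distribʳ-sumCl (s * s) (λ i a → sumCl λ j b → [ adj F i j ∧ g i a j b ]))) ⟩
      flaggedPairs g * (s * s) ∎
      where open ≤-Reasoning

    module _ (W : Fin ℓ → VSet n) (P⊆W : ∀ i a → P i (suc a) ⊆ᵥ W i)
             (P-disjoint : ∀ i a b v → P i a v ≡ true → P i b v ≡ true → a ≡ b) where

      p*s≤∣∣ : ∀ i → p i * s ≤ ∣ W i ∣ᵥ
      p*s≤∣∣ i = begin
        p i * s                       ≡⟨ sumF-const {p i} s ⟨
        sumF {p i} (λ _ → s)          ≡⟨ sumF-cong (λ a → size i a) ⟨
        sumF (λ a → ∣ P i (suc a) ∣ᵥ)  ≤⟨ sumF-∣∣ᵥ-disjoint (λ a → P i (suc a)) (W i) (P⊆W i)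
                                        (λ a b v Pₐ Pᵦ → suc-injective (P-disjoint i (suc a) (suc b) v Pₐ Pᵦ)) ⟩
        ∣ W i ∣ᵥ                      ∎
        where open ≤-Reasoning

      clusterPairs*s²≤ : clusterPairs * (s * s) ≤ sumPairs (λ i j → [ adj F i j ] * (∣ W i ∣ᵥ * ∣ W j ∣ᵥ))
      clusterPairs*s²≤ = begin
        clusterPairs * (s * s)
          ≡⟨ *-distribʳ-sumPairs (s * s) (λ i j → [ adj F i j ] * (p i * p j)) ⟩
        sumPairs (λ i j → [ adj F i j ] * (p i * p j) * (s * s))
          ≡⟨ sumPairs-cong (λ i j → solve 4 (λ f pᵢ pⱼ s → f :* (pᵢ :* pⱼ) :* (s :* s)
                                                       := f :* ((pᵢ :* s) :* (pⱼ :* s)))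
                                            refl [ adj F i j ] (p i) (p j) s) ⟩
        sumPairs (λ i j → [ adj F i j ] * ((p i * s) * (p j * s)))
          ≤⟨ sumPairs-mono-≤ (λ i j → *-monoʳ-≤ [ adj F i j ] (*-mono-≤ (p*s≤∣∣ i) (p*s≤∣∣ j))) ⟩
        sumPairs (λ i j → [ adj F i j ] * (∣ W i ∣ᵥ * ∣ W j ∣ᵥ)) ∎
        where open ≤-Reasoning

module ClusterDensities {n ℓ : ℕ} (H : Graph n) (F : Graph ℓ) {p : Fin ℓ → ℕ}
                        (P : (i : Fin ℓ) → Fin (suc (p i)) → VSet n) where

  open import Data.Rational using (_*_; _≤_)
  open import Data.Rational.Properties using (_≤?_; ≤-trans; <⇒≤; ≰⇒>; *-assoc; module ≤-Reasoning)
  open import Data.Bool.Properties using (∧-conicalʳ; ∨-conicalˡ; ∨-conicalʳ)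
  open ClusterSums p
  open ClusterPairs H F P

  sparse : ℚ → PairFlag
  sparse c i a j b = isNo (c ≤? dens H (P i (suc a)) (P j (suc b)))

  sparse-comm : ∀ c i a j b → sparse c i a j b ≡ sparse c j b i a
  sparse-comm c i a j b = cong (λ d → isNo (c ≤? d)) (dens-comm H (P i (suc a)) (P j (suc b)))

  unflagged-sparse∨ᶠ : ∀ c g {R : VSet n → VSet n → Set} →
    (∀ i a j b → adj F i j ≡ true → g i a j b ≡ false → R (P i (suc a)) (P j (suc b))) →
    ∀ {x y} → InUnflaggedPair (sparse c ∨ᶠ g) x y →
    ∃[ i ] ∃[ a ] ∃[ j ] ∃[ b ] (adj F i j ≡ true × P i (suc a) x ≡ true × P j (suc b) y ≡ true
                                 × R (P i (suc a)) (P j (suc b)) × c ≤ dens H (P i (suc a)) (P j (suc b)))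
  unflagged-sparse∨ᶠ c g g-good (i , a , j , b , Fij , Pᵢₐx , Pⱼᵦy , unflagged) =
    i , a , j , b , Fij , Pᵢₐx , Pⱼᵦy , g-good i a j b Fij (∨-conicalʳ _ _ unflagged) ,
    isNo≡false⇒ (c ≤? dens H (P i (suc a)) (P j (suc b))) (∨-conicalˡ _ _ unflagged)

  sumF-deg*exceptional≤ : ∀ Δ → (∀ x → ℕ→ℚ (deg H x) ≤ Δ) →
    ℕ→ℚ (sumF (λ x → deg H x ℕ.* exceptional x)) ≤ Δ * ℕ→ℚ (sumF (λ i → ∣ P i zero ∣ᵥ))
  sumF-deg*exceptional≤ Δ Δ-max =
    subst (λ m → ℕ→ℚ (sumF (λ x → deg H x ℕ.* exceptional x)) ≤ Δ * ℕ→ℚ m) sumF-exceptional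
          (ℕ→ℚ-sumF-*-≤ Δ (deg H) exceptional Δ-max)

  ℕ→ℚ-sumCl²-≤ : ∀ c (f g : (i : Fin ℓ) → Fin (p i) → (j : Fin ℓ) → Fin (p j) → ℕ) →
    (∀ i a j b → ℕ→ℚ (f i a j b) ≤ c * ℕ→ℚ (g i a j b)) →
    ℕ→ℚ (sumCl (λ i a → sumCl (f i a))) ≤ c * ℕ→ℚ (sumCl (λ i a → sumCl (g i a)))
  ℕ→ℚ-sumCl²-≤ c f g f≤cg =
    ℕ→ℚ-sumF-≤ c _ _ λ i → ℕ→ℚ-sumF-≤ c _ _ λ a → ℕ→ℚ-sumF-≤ c _ _ λ j → ℕ→ℚ-sumF-≤ c _ _ (f≤cg i a j)

  module _ (s : ℕ) (size : ∀ i a → ∣ P i (suc a) ∣ᵥ ≡ s) where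

    sumPairs-flaggedEdges-sparse≤ : ∀ c → 0ℚ ≤ c →
      ℕ→ℚ (sumPairs (flaggedEdges (sparse c))) ≤ c * ℕ→ℚ (clusterPairs ℕ.* (s ℕ.* s))
    sumPairs-flaggedEdges-sparse≤ c 0≤c = begin
      ℕ→ℚ (sumPairs (flaggedEdges (sparse c)))
        ≡⟨ cong ℕ→ℚ (sumPairs-flaggedEdges (sparse c)) ⟩
      ℕ→ℚ (sumCl (λ i a → sumCl λ j b → [ adj F i j ∧ sparse c i a j b ] ℕ.* eUW H (P i (suc a)) (P j (suc b))))
        ≤⟨ ℕ→ℚ-sumCl²-≤ c _ _ (λ i a j b → ℕ→ℚ-[]*-≤ c _ _ _ λ Fij∧sparse →
             sparse-edges i a j b (∧-conicalʳ (adj F i j) (sparse c i a j b) Fij∧sparse)) ⟩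
      c * ℕ→ℚ (sumCl (λ i a → sumCl λ j b → [ adj F i j ∧ sparse c i a j b ] ℕ.* (s ℕ.* s)))
        ≤⟨ *-monoˡ-≤-0≤ 0≤c (ℕ→ℚ-mono-≤ (sumCl-mono-≤ λ i a → sumCl-mono-≤ λ j b →
             ℕₚ.*-monoˡ-≤ (s ℕ.* s) ([]-∧-≤ʳ (adj F i j) (sparse c i a j b)))) ⟩
      c * ℕ→ℚ (sumCl (λ i a → sumCl λ j b → [ adj F i j ] ℕ.* (s ℕ.* s)))
        ≡⟨ cong (λ m → c * ℕ→ℚ m)
                (trans (sumCl-cong λ i a → sym (*-distribʳ-sumCl (s ℕ.* s) (λ j b → [ adj F i j ])))
                       (sym (*-distribʳ-sumCl (s ℕ.* s) (λ i a → sumCl λ j b → [ adj F i j ])))) ⟩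
      c * ℕ→ℚ (sumCl (λ i a → sumCl λ j b → [ adj F i j ]) ℕ.* (s ℕ.* s))
        ≡⟨ cong (λ m → c * ℕ→ℚ (m ℕ.* (s ℕ.* s))) (sumCl²-const (λ i j → [ adj F i j ])) ⟩
      c * ℕ→ℚ (clusterPairs ℕ.* (s ℕ.* s)) ∎
      where
      open ≤-Reasoning
      sparse-edges : ∀ i a j b → sparse c i a j b ≡ true →
                     ℕ→ℚ (eUW H (P i (suc a)) (P j (suc b))) ≤ c * ℕ→ℚ (s ℕ.* s)
      sparse-edges i a j b sparse-ij = subst (λ m → ℕ→ℚ (eUW H (P i (suc a)) (P j (suc b))) ≤ c * ℕ→ℚ m)
        (cong₂ ℕ._*_ (size i a) (size j b))
        (dens≤⇒eUW≤ H (P i (suc a)) (P j (suc b)) c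
          (<⇒≤ (≰⇒> (isNo≡true⇒ (c ≤? dens H (P i (suc a)) (P j (suc b))) sparse-ij))))

    sumPairs-flaggedEdges-few≤ : ∀ g c → 0ℚ ≤ c → ℕ→ℚ (flaggedPairs g) ≤ c * ℕ→ℚ clusterPairs →
      ℕ→ℚ (sumPairs (flaggedEdges g)) ≤ c * ℕ→ℚ (clusterPairs ℕ.* (s ℕ.* s))
    sumPairs-flaggedEdges-few≤ g c 0≤c few = begin
      ℕ→ℚ (sumPairs (flaggedEdges g))       ≤⟨ ℕ→ℚ-mono-≤ (sumPairs-flaggedEdges≤ s size g) ⟩
      ℕ→ℚ (flaggedPairs g ℕ.* (s ℕ.* s))    ≡⟨ ℕ→ℚ-* (flaggedPairs g) (s ℕ.* s) ⟩
      ℕ→ℚ (flaggedPairs g) * ℕ→ℚ (s ℕ.* s)  ≤⟨ *-monoʳ-≤-0≤ (0≤ℕ→ℚ (s ℕ.* s)) few ⟩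
      c * ℕ→ℚ clusterPairs * ℕ→ℚ (s ℕ.* s)  ≡⟨ *-assoc c _ _ ⟩
      c * (ℕ→ℚ clusterPairs * ℕ→ℚ (s ℕ.* s)) ≡⟨ cong (c *_) (ℕ→ℚ-* clusterPairs (s ℕ.* s)) ⟨
      c * ℕ→ℚ (clusterPairs ℕ.* (s ℕ.* s))  ∎
      where open ≤-Reasoning

    ≤dens⇒clusterPairs*s²≤ : ∀ c → 0ℚ ≤ c → (W : Fin ℓ → VSet n) → (∀ i a → P i (suc a) ⊆ᵥ W i) →
      (∀ i a b v → P i a v ≡ true → P i b v ≡ true → a ≡ b) →
      (∀ i j v → W i v ≡ true → W j v ≡ true → i ≡ j) → (∀ i j → adj F i j ≡ true → c ≤ dens H (W i) (W j)) →
      c * ℕ→ℚ (clusterPairs ℕ.* (s ℕ.* s)) ≤ ℕ→ℚ 2 * ℕ→ℚ (eG H)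
    ≤dens⇒clusterPairs*s²≤ c 0≤c W P⊆W P-disjoint W-disjoint dense =
      ≤-trans (*-monoˡ-≤-0≤ 0≤c (ℕ→ℚ-mono-≤ (clusterPairs*s²≤ s size W P⊆W P-disjoint)))
              (≤dens⇒≤2*eG H F W c W-disjoint dense)

module _ {ε γ Ω k n : ℚ} (0≤ε : 0ℚ ℚ.≤ ε) (γ>0 : 0ℚ ℚ.< γ) (0≤n : 0ℚ ℚ.≤ n) (0≤k : 0ℚ ℚ.≤ k) where

  open import Data.Rational using (1ℚ; _+_; _*_; _≤_)
  open import Data.Rational.Properties
  open import Data.Rational.Solver using (module +-*-Solver)
  open +-*-Solver using (solve; _:+_; _:*_; _:=_)

  private
    γ⁻¹ : ℚ
    γ⁻¹ = 1/_ γ {{>-nonZero γ>0}}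

    0≤γ⁻¹ : 0ℚ ≤ γ⁻¹
    0≤γ⁻¹ = <⇒≤ (positive⁻¹ γ⁻¹ {{1/pos⇒pos γ {{ℚ.positive γ>0}}}})

  bad-edge-arithmetic : ∀ (E D T T′ : ℕ) {R : ℚ} →
    2 ℕ.* E ℕ.≤ 2 ℕ.* D ℕ.+ T ℕ.+ 2 ℕ.* T′ →
    ℕ→ℚ D ≤ (Ω * k) * (ε * n) → ℕ→ℚ T ≤ (γ * γ) * R → ℕ→ℚ T′ ≤ ε * R → γ * R ≤ ℕ→ℚ 2 * (k * n) →
    ℕ→ℚ E ≤ (ℕ→ℚ 4 * ε * γ⁻¹ + ε * Ω + γ) * n * k
  bad-edge-arithmetic E D T T′ {R} 2E≤ D≤ T≤ T′≤ γR≤ = *-cancelˡ-≤-pos (ℕ→ℚ 2) (begin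
    ℕ→ℚ 2 * ℕ→ℚ E                    ≡⟨ ℕ→ℚ-* 2 E ⟨
    ℕ→ℚ (2 ℕ.* E)                    ≤⟨ ℕ→ℚ-mono-≤ 2E≤ ⟩
    ℕ→ℚ (2 ℕ.* D ℕ.+ T ℕ.+ 2 ℕ.* T′)
      ≡⟨ trans (ℕ→ℚ-+ (2 ℕ.* D ℕ.+ T) _)
               (cong₂ _+_ (trans (ℕ→ℚ-+ (2 ℕ.* D) T) (cong (_+ ℕ→ℚ T) (ℕ→ℚ-* 2 D))) (ℕ→ℚ-* 2 T′)) ⟩
    ℕ→ℚ 2 * ℕ→ℚ D + ℕ→ℚ T + ℕ→ℚ 2 * ℕ→ℚ T′
      ≤⟨ +-mono-≤ (+-mono-≤ (*-monoˡ-≤-0≤ (0≤ℕ→ℚ 2) D≤) T≤γ2kn) (*-monoˡ-≤-0≤ (0≤ℕ→ℚ 2) T′≤εγ⁻¹2kn) ⟩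
    ℕ→ℚ 2 * ((Ω * k) * (ε * n)) + γ * (ℕ→ℚ 2 * (k * n)) + ℕ→ℚ 2 * (ε * (γ⁻¹ * (ℕ→ℚ 2 * (k * n))))
      ≡⟨ solve 7 (λ t ε γ u Ω k n →
           t :* ((Ω :* k) :* (ε :* n)) :+ γ :* (t :* (k :* n)) :+ t :* (ε :* (u :* (t :* (k :* n))))
           := t :* ((t :* ε :* u :+ ε :* Ω :+ γ) :* n :* k)) refl (ℕ→ℚ 2) ε γ γ⁻¹ Ω k n ⟩
    ℕ→ℚ 2 * ((ℕ→ℚ 2 * ε * γ⁻¹ + ε * Ω + γ) * n * k)
      ≤⟨ *-monoˡ-≤-0≤ (0≤ℕ→ℚ 2) (*-monoʳ-≤-0≤ 0≤k (*-monoʳ-≤-0≤ 0≤n (+-monoˡ-≤ γ (+-monoˡ-≤ (ε * Ω)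
           (*-monoʳ-≤-0≤ 0≤γ⁻¹ (*-monoʳ-≤-0≤ 0≤ε (ℕ→ℚ-mono-≤ {2} {4} (ℕ.s≤s (ℕ.s≤s ℕ.z≤n))))))))) ⟩
    ℕ→ℚ 2 * ((ℕ→ℚ 4 * ε * γ⁻¹ + ε * Ω + γ) * n * k) ∎)
    where
    open ≤-Reasoning
    R≤γ⁻¹2kn : R ≤ γ⁻¹ * (ℕ→ℚ 2 * (k * n))
    R≤γ⁻¹2kn = begin
      R               ≡⟨ sym (*-identityˡ R) ⟩
      1ℚ * R          ≡⟨ cong (_* R) (sym (*-inverseˡ γ {{>-nonZero γ>0}})) ⟩
      γ⁻¹ * γ * R     ≡⟨ *-assoc γ⁻¹ γ R ⟩
      γ⁻¹ * (γ * R)   ≤⟨ *-monoˡ-≤-0≤ 0≤γ⁻¹ γR≤ ⟩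
      γ⁻¹ * (ℕ→ℚ 2 * (k * n)) ∎
    T≤γ2kn : ℕ→ℚ T ≤ γ * (ℕ→ℚ 2 * (k * n))
    T≤γ2kn = ≤-trans T≤ (≤-trans (≤-reflexive (*-assoc γ γ R)) (*-monoˡ-≤-0≤ (<⇒≤ γ>0) γR≤))
    T′≤εγ⁻¹2kn : ℕ→ℚ T′ ≤ ε * (γ⁻¹ * (ℕ→ℚ 2 * (k * n)))
    T′≤εγ⁻¹2kn = ≤-trans T′≤ (*-monoˡ-≤-0≤ 0≤ε R≤γ⁻¹2kn)

open import Data.Rational using (_≤_; _<_)

lemma2p10 :
  (m z : ℕ) (ε γ Ω k : ℚ) (ε>0 : 0ℚ < ε) (γ>0 : 0ℚ < γ) → 0ℚ < Ω → 0ℚ < k →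
  (n ℓ : ℕ) (H : Graph n) (F : Graph ℓ) →
  -- maxdeg(F) ≤ m
  (∀ i → deg F i ℕ.≤ m) →
  -- 𝒵 = {Z_1,…,Z_z} partition of V(H): Z_x = {v | zone v ≡ x}, parts nonempty
  (zone : Fin n → Fin z) → (∀ x → ∃[ v ] zone v ≡ x) →
  -- W_1,…,W_ℓ pairwise disjoint with 2|W_i| ≥ |W_j|
  (W : Fin ℓ → VSet n) →
  (∀ i j v → i ≢ j → W i v ≡ true → W j v ≡ false) →
  (∀ i j → ∣ W j ∣ᵥ ℕ.≤ 2 ℕ.* ∣ W i ∣ᵥ) →
  -- W_i^(0),…,W_i^(p_i) a partition of W_i
  (p : Fin ℓ → ℕ) (P : (i : Fin ℓ) → Fin (suc (p i)) → VSet n) →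
  (∀ i a v → P i a v ≡ true → W i v ≡ true) →
  (∀ i v → W i v ≡ true → ∃[ a ] P i a v ≡ true) →
  (∀ i a b v → P i a v ≡ true → P i b v ≡ true → a ≡ b) →
  -- (a) 1/ε ≤ p_i
  (∀ i → 1/_ ε {{>-nonZero ε>0}} ≤ ℕ→ℚ (p i)) →
  -- (b) |W_i^(i')| = |W_j^(j')| for i' ∈ [p_i], j' ∈ [p_j]
  (∀ i j (a : Fin (p i)) (b : Fin (p j)) → ∣ P i (suc a) ∣ᵥ ≡ ∣ P j (suc b) ∣ᵥ) →
  -- (c) each W_i^(i'), i' ∈ [p_i], lies inside some Z_x
  (∀ i (a : Fin (p i)) → ∃[ x ] (∀ v → P i (suc a) v ≡ true → zone v ≡ x)) →
  -- (d) Σ_i |W_i^(0)| < ε Σ_i |W_i|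
  (ℕ→ℚ (sumF (λ i → ∣ P i zero ∣ᵥ)) < ε ℚ.* ℕ→ℚ (sumF (λ i → ∣ W i ∣ᵥ))) →
  -- (e) at most ε|𝒴| pairs of 𝒴 are ε-irregular: there is a set S of
  --     (ordered) index tuples of 𝒴 with |S| ≤ ε|𝒴| containing every irregular pair
  (Σ ((i : Fin ℓ) → Fin (p i) → (j : Fin ℓ) → Fin (p j) → Bool) λ S → ((ℕ→ℚ (sumF (λ i → sumF (λ (a : Fin (p i)) → sumF (λ j → sumF (λ (b : Fin (p j)) →
             [ adj F i j ∧ S i a j b ])))))
           ≤ ε ℚ.* ℕ→ℚ (sumF (λ i → sumF (λ j → [ adj F i j ] ℕ.* (p i ℕ.* p j)))))
         × (∀ i a j b → adj F i j ≡ true → S i a j b ≡ false →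
             Regular ε H (P i (suc a)) (P j (suc b))))) →
  -- maxdeg(H) ≤ Ωk, e(H) ≤ kn
  (∀ x → ℕ→ℚ (deg H x) ≤ Ω ℚ.* k) →
  ℕ→ℚ (eG H) ≤ k ℚ.* ℕ→ℚ n →
  -- every edge of H goes between W_i and W_j for some ij ∈ E(F)
  (∀ x y → adj H x y ≡ true →
     ∃[ i ] ∃[ j ] (adj F i j ≡ true × W i x ≡ true × W j y ≡ true)) →
  -- d(W_i,W_j) ≥ γ for ij ∈ E(F)
  (∀ i j → adj F i j ≡ true → γ ≤ dens H (W i) (W j)) →
  -- conclusion: a set B of at most (4ε/γ + εΩ + γ)nk edges such that every other
  -- edge lies in an ε-regular pair (W_i^(i'),W_j^(j')), i',j' ≠ 0, of density ≥ γ²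
  Σ (Fin n → Fin n → Bool) λ B → ((ℕ→ℚ (sumF (λ x → sumF (λ y →
             [ (toℕ x <ᵇ toℕ y) ∧ adj H x y ∧ B x y ])))
           ≤ (ℕ→ℚ 4 ℚ.* ε ℚ.* (1/_ γ {{>-nonZero γ>0}}) ℚ.+ ε ℚ.* Ω ℚ.+ γ)
               ℚ.* ℕ→ℚ n ℚ.* k)
         × (∀ x y → (toℕ x ℕ.< toℕ y) → adj H x y ≡ true → B x y ≡ false →
             ∃[ i ] ∃[ a ] ∃[ j ] ∃[ b ]
               (adj F i j ≡ true
                × P i (suc a) x ≡ true × P j (suc b) y ≡ true
                × Regular ε H (P i (suc a)) (P j (suc b))
                × γ ℚ.* γ ≤ dens H (P i (suc a)) (P j (suc b)))))

lemma2p10 _ _ ε γ Ω k ε>0 γ>0 Ω>0 k>0 n ℓ H F _ _ _ W W-exclusive _ p P P⊆W W⊆P P-disjoint _ equal-size _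
          exceptional-small (S , S-few , S-regular) Δ≤Ωk eH≤kn edges-in-W W-dense =
  B , subst (_≤ _) (cong ℕ→ℚ (sym (sumPairs<-∧ (λ x y → adj H x y ∧ B x y)))) bound ,
  λ x y _ _ B≡false → unflagged-sparse∨ᶠ (γ ℚ.* γ) S {Regular ε H} S-regular
                                        (isNo≡false⇒ (inUnflaggedPair? rejected x y) B≡false)
  where
  open import Data.Rational.Properties using (<⇒≤; ≤-trans)
  open ClusterPairs H F P
  open ClusterDensities H F P

  rejected : PairFlag
  rejected = sparse (γ ℚ.* γ) ∨ᶠ S
  B : Fin n → Fin n → Bool
  B x y = isNo (inUnflaggedPair? rejected x y)
  s : ℕ
  s = proj₁ (common-value (λ i a → ∣ P i (suc a) ∣ᵥ) equal-size)
  size : ∀ i a → ∣ P i (suc a) ∣ᵥ ≡ s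
  size = proj₂ (common-value (λ i a → ∣ P i (suc a) ∣ᵥ) equal-size)
  W-unique : ∀ i j v → W i v ≡ true → W j v ≡ true → i ≡ j
  W-unique = exclusive⇒unique W W-exclusive
  bound : ℕ→ℚ (sumPairs< (λ x y → [ adj H x y ∧ B x y ]))
          ≤ (ℕ→ℚ 4 ℚ.* ε ℚ.* (1/_ γ {{>-nonZero γ>0}}) ℚ.+ ε ℚ.* Ω ℚ.+ γ) ℚ.* ℕ→ℚ n ℚ.* k
  bound = bad-edge-arithmetic (<⇒≤ ε>0) γ>0 (0≤ℕ→ℚ n) (<⇒≤ k>0)
    (sumPairs< (λ x y → [ adj H x y ∧ B x y ])) (sumF (λ x → deg H x ℕ.* exceptional x))
    (sumPairs (flaggedEdges (sparse (γ ℚ.* γ)))) (sumPairs (flaggedEdges S))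
    (uncovered-edges≤ (edgesAlongF W edges-in-W W⊆P) (sparse (γ ℚ.* γ)) S (sparse-comm (γ ℚ.* γ))
                      B (λ x y → isNo≡true⇒ (inUnflaggedPair? rejected x y)))
    (≤-trans (sumF-deg*exceptional≤ (Ω ℚ.* k) Δ≤Ωk) (*-monoˡ-≤-0≤ (0≤* (<⇒≤ Ω>0) (<⇒≤ k>0))
      (≤-trans (<⇒≤ exceptional-small) (*-monoˡ-≤-0≤ (<⇒≤ ε>0) (ℕ→ℚ-mono-≤ (sumF-∣∣ᵥ≤n W W-unique))))))
    (sumPairs-flaggedEdges-sparse≤ s size (γ ℚ.* γ) (0≤* (<⇒≤ γ>0) (<⇒≤ γ>0)))
    (sumPairs-flaggedEdges-few≤ s size S ε (<⇒≤ ε>0) S-few)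
    (≤-trans (≤dens⇒clusterPairs*s²≤ s size γ (<⇒≤ γ>0) W (λ i a → P⊆W i (suc a)) P-disjoint W-unique W-dense)
             (*-monoˡ-≤-0≤ (0≤ℕ→ℚ 2) eH≤kn))
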